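{- Let $n>2$ be an integer and $r\ge1$ an integer with $2^r+1<2^n$, let $s_i=(2^r+1)2^{n+i}+1$ for $i\in\mathbb{N}$, and let $S=P_{2^r+1}(n)$. If $s\in S$ and $s\not\equiv 0\pmod{s_0}$, then $s+1\in S$. Moreover, $w(i+1)\le w(i)+1$ for $1\le i\le s_0-1$.
   Context: $P_{2^r+1}(n)$ is the numerical semigroup consisting of all finite non-negative integer linear combinations of $\{(2^r+1)2^{n+i}+1\mid i\in\mathbb{N}\}$. For an integer $i$, $w(i)$ denotes the least element of $S$ congruent to $i$ modulo $s_0$ (so $w(s_0)=w(0)=0$). -}

module Defs where

open import Data.Nat using (ℕ; zero; suc; _+_; _*_; _^_; _≤_)
open import Data.Nat.DivMod using (_%_)
open import Data.List using (List; map)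
open import Data.Nat.ListAction using (sum)
open import Data.Product using (Σ; _×_)
open import Relation.Binary.PropositionalEquality using (_≡_)

-- s_i = (2^r+1) 2^(n+i) + 1  (written as suc so that it is visibly nonzero)
gen : ℕ → ℕ → ℕ → ℕ
gen n r i = suc ((2 ^ r + 1) * 2 ^ (n + i))

s₀ : ℕ → ℕ → ℕ
s₀ n r = gen n r 0

-- membership in S = P_{2^r+1}(n): s is a finite non-negative integer linear
-- combination of the generators s_i, i.e. a sum of a finite list
-- (multiset, with repetition) of generators.
InS : ℕ → ℕ → ℕ → Set
InS n r s = Σ (List ℕ) (λ is → sum (map (gen n r) is) ≡ s)

-- IsW n r i x : x = w(i), the least element of S congruent to i modulo s_0.
IsW : ℕ → ℕ → ℕ → ℕ → Set
IsW n r i x =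
  InS n r x × (x % s₀ n r ≡ i % s₀ n r)
  × ((y : ℕ) → InS n r y → y % s₀ n r ≡ i % s₀ n r → x ≤ y)

{-# OPTIONS --safe #-}
-- Since s_j + s_j = s_{j+1} + 1, replacing one generator s_{j+1} (j ≥ 0) of a
-- representation of s by two copies of s_j represents s + 1. This is impossible
-- only when every generator used is s_0, that is, when s_0 divides s. The bound
-- w(i+1) ≤ w(i) + 1 follows, because w(i) + 1 lies in S and is congruent to i + 1.
module Submission where

open import Defs
open import Data.Nat using (ℕ; zero; suc; _+_; _*_; _^_; _≤_; _<_; _∸_)
open import Data.Nat.Properties using (+-suc; +-comm; +-assoc; <⇒≢)
open import Data.Nat.DivMod using (_%_; %-distribˡ-+; m≤n⇒m%n≡m)
open import Data.Nat.Divisibility using (_∣_; _∣0; ∣-refl; ∣m∣n⇒∣m+n; n∣m⇒m%n≡0)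
open import Data.Nat.ListAction using (sum)
open import Data.Nat.Solver using (module +-*-Solver)
open import Data.List using (List; []; _∷_; map)
open import Data.Product using (_×_; _,_)
open import Data.Sum using (_⊎_; inj₁; inj₂)
open import Data.Empty using (⊥-elim)
open import Relation.Binary.PropositionalEquality
  using (_≡_; _≢_; refl; sym; trans; cong; subst)

gen-+-gen : ∀ n r j → gen n r j + gen n r j ≡ suc (gen n r (suc j))
gen-+-gen n r j rewrite +-suc n j = double (2 ^ r + 1) (2 ^ (n + j))
  where
  open +-*-Solver
  double : ∀ m y → suc (m * y) + suc (m * y) ≡ suc (suc (m * (2 * y)))
  double = solve 2 (λ m y → (con 1 :+ m :* y) :+ (con 1 :+ m :* y)
                          := con 1 :+ (con 1 :+ m :* (con 2 :* y))) refl

s₀-∣-sum⊎InS-suc : ∀ n r (is : List ℕ) →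
  s₀ n r ∣ sum (map (gen n r) is) ⊎ InS n r (suc (sum (map (gen n r) is)))
s₀-∣-sum⊎InS-suc n r [] = inj₁ (s₀ n r ∣0)
s₀-∣-sum⊎InS-suc n r (zero ∷ is) with s₀-∣-sum⊎InS-suc n r is
... | inj₁ s₀∣rest = inj₁ (∣m∣n⇒∣m+n ∣-refl s₀∣rest)
... | inj₂ (js , js-sum) =
  inj₂ (zero ∷ js , trans (cong (s₀ n r +_) js-sum) (+-suc (s₀ n r) _))
s₀-∣-sum⊎InS-suc n r (suc j ∷ is) = inj₂ (j ∷ j ∷ is ,
  trans (sym (+-assoc (gen n r j) (gen n r j) _))
        (cong (_+ sum (map (gen n r) is)) (gen-+-gen n r j)))

InS-suc : ∀ n r s → InS n r s → s % s₀ n r ≢ 0 → InS n r (suc s)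
InS-suc n r s (is , is-sum) s≢0 with s₀-∣-sum⊎InS-suc n r is
... | inj₁ s₀∣sum = ⊥-elim (s≢0 (subst (λ x → x % s₀ n r ≡ 0) is-sum
                                      (n∣m⇒m%n≡0 _ (s₀ n r) s₀∣sum)))
... | inj₂ (js , js-sum) = js , trans js-sum (cong suc is-sum)

%-cong-suc : ∀ {a b} d → a % suc d ≡ b % suc d → suc a % suc d ≡ suc b % suc d
%-cong-suc {a} {b} d eq = trans (%-distribˡ-+ 1 a (suc d))
  (trans (cong (λ x → (1 % suc d + x) % suc d) eq) (sym (%-distribˡ-+ 1 b (suc d))))

IsW-suc-≤ : ∀ n r i a b → i % s₀ n r ≢ 0 →
  IsW n r i a → IsW n r (suc i) b → b ≤ suc a
IsW-suc-≤ n r i a b i≢0 (a∈S , a≡i , _) (_ , _ , b-least) =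
  b-least (suc a) (InS-suc n r a a∈S a≢0) (%-cong-suc (s₀ n r ∸ 1) a≡i)
  where
  a≢0 : a % s₀ n r ≢ 0
  a≢0 a≡0 = i≢0 (trans (sym a≡i) a≡0)

lemma11 : (n r : ℕ) → 2 < n → 1 ≤ r → 2 ^ r + 1 < 2 ^ n →
    ((s : ℕ) → InS n r s → s % s₀ n r ≢ 0 → InS n r (suc s))
    × ((i a b : ℕ) → 1 ≤ i → i ≤ s₀ n r ∸ 1 →
        IsW n r i a → IsW n r (suc i) b → b ≤ a + 1)
lemma11 n r _ _ _ = InS-suc n r , w-suc-≤
  where
  w-suc-≤ : (i a b : ℕ) → 1 ≤ i → i ≤ s₀ n r ∸ 1 →
    IsW n r i a → IsW n r (suc i) b → b ≤ a + 1
  w-suc-≤ i a b 1≤i i≤s₀-1 wi wsi rewrite +-comm a 1 =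
    IsW-suc-≤ n r i a b i≢0 wi wsi
    where
    i≢0 : i % s₀ n r ≢ 0
    i≢0 i≡0 = <⇒≢ 1≤i (sym (trans (sym (m≤n⇒m%n≡m i≤s₀-1)) i≡0))
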